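{- Let $\mathcal{G}\subseteq\mathrm{DAG}(N)$ be a facet of $\mathbb{F}$ (i.e., $\mathrm{conv}\{\eta_G:G\in\mathcal{G}\}$ is a facet of $\mathbb{F}$) which does not contain the empty graph. Then $\mathcal{G}$ is closed under super-graphs: if $G\in\mathcal{G}$ is a subgraph of $H\in\mathrm{DAG}(N)$ then $H\in\mathcal{G}$. Moreover, for every $(a|B)\in\Upsilon$ there exists $G\in\mathcal{G}$ with $\mathrm{pa}_G(a)=B$.
   Context: Let $N$ be a finite set with $n=|N|\ge 2$, and let $\mathrm{DAG}(N)$ be the set of acyclic directed graphs with node set $N$. For $G\in\mathrm{DAG}(N)$ and $a\in N$, $\mathrm{pa}_G(a)=\{b\in N: b\to a \text{ in } G\}$. The empty graph has no edges. Let $\Upsilon=\{(a|B): a\in N,\ \emptyset\neq B\subseteq N\setminus\{a\}\}$. For $G\in\mathrm{DAG}(N)$ the family-variable vector $\eta_G\in\mathbb{R}^{\Upsilon}$ is given by $\eta_G(a|B)=1$ if $B=\mathrm{pa}_G(a)$ and $0$ otherwise. The family-variable polytope is $\mathbb{F}=\mathrm{conv}\{\eta_G: G\in\mathrm{DAG}(N)\}$, of dimension $|\Upsilon|$; its vertices are exactly the vectors $\eta_G$. A facet of a polytope is a face of dimension one less than the polytope. A set $\mathcal{G}\subseteq\mathrm{DAG}(N)$ is called a facet of $\mathbb{F}$ if $\mathrm{conv}\{\eta_G:G\in\mathcal{G}\}$ is a facet of $\mathbb{F}$.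
   Formalization: The convex hulls, faces and dimensions in the facet condition on 𝒢 are taken in ℚ^Υ instead of ℝ^Υ, with rational coefficients for the supporting inequality and for affine dependences. -}

module Defs where

open import Data.Nat as ℕ using (ℕ; zero; suc)
open import Data.Bool using (Bool; true; false; T; not; _∧_; _∨_; if_then_else_)
open import Data.Bool.Properties using (T?)
open import Data.Fin using (Fin)
open import Data.Fin.Subset using (Subset)
open import Data.Vec as Vec using (Vec; []; _∷_; lookup; tabulate)
open import Data.Vec.Properties using (≡-dec)
import Data.Bool.Properties as BoolP
open import Data.List as List using (List; []; _∷_; _++_; map; allFin; foldr)
open import Data.List.Relation.Unary.All using (All)
open import Data.Rational using (ℚ; 0ℚ; 1ℚ; _+_; _*_; _≤_)
open import Data.Product using (Σ; ∃; _×_; _,_; proj₁; proj₂)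
open import Data.Unit using (⊤)
open import Relation.Nullary using (¬_; yes; no; does)
open import Relation.Binary.PropositionalEquality using (_≡_)
open import Relation.Binary.Construct.Closure.Transitive using (TransClosure)

-- Graphs on N = Fin n, as adjacency matrices: edge G a b = true iff a → b.

Graph : ℕ → Set
Graph n = Vec (Vec Bool n) n

Edge : ∀ {n} → Graph n → Fin n → Fin n → Set
Edge G a b = T (lookup (lookup G a) b)

Acyclic : ∀ {n} → Graph n → Set
Acyclic {n} G = ∀ (a : Fin n) → ¬ TransClosure (Edge G) a a

emptyGraph : ∀ n → Graph n
emptyGraph n = Vec.replicate n (Vec.replicate n false)

_⊆G_ : ∀ {n} → Graph n → Graph n → Set
G ⊆G H = ∀ a b → Edge G a b → Edge H a b

pa : ∀ {n} → Graph n → Fin n → Subset n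
pa G a = tabulate (λ b → lookup (lookup G b) a)

nonemptyᵇ : ∀ {n} → Subset n → Bool
nonemptyᵇ = Vec.foldr _ _∨_ false

isΥ : ∀ {n} → Fin n → Subset n → Bool
isΥ a B = nonemptyᵇ B ∧ not (lookup B a)

Υ : ℕ → Set
Υ n = Σ (Fin n × Subset n) (λ p → T (isΥ (proj₁ p) (proj₂ p)))

Point : ℕ → Set
Point n = Υ n → ℚ

_≟S_ : ∀ {n} (B C : Subset n) → _
_≟S_ = ≡-dec BoolP._≟_

η : ∀ {n} → Graph n → Point n
η G ((a , B) , _) = if does (pa G a ≟S B) then 1ℚ else 0ℚ

sumℚ : List ℚ → ℚ
sumℚ = foldr _+_ 0ℚ

sumFin : ∀ {k} → (Fin k → ℚ) → ℚ
sumFin {k} f = sumℚ (map f (allFin k))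

allSubsets : ∀ n → List (Subset n)
allSubsets zero = [] ∷ []
allSubsets (suc n) = map (true ∷_) (allSubsets n) ++ map (false ∷_) (allSubsets n)

sumΥ : ∀ {n} → (Υ n → ℚ) → ℚ
sumΥ {n} f = sumFin (λ a → sumℚ (map (term a) (allSubsets n)))
  where
  term : Fin n → Subset n → ℚ
  term a B with T? (isΥ a B)
  ... | yes p = f ((a , B) , p)
  ... | no _  = 0ℚ

_·_ : ∀ {n} → Point n → Point n → ℚ
c · x = sumΥ (λ u → c u * x u)

InConv : ∀ {n} → (Graph n → Set) → Point n → Set
InConv {n} 𝒢 x =
  ∃ λ (gs : List (Graph n × ℚ)) →
    All (λ p → 𝒢 (proj₁ p) × 0ℚ ≤ proj₂ p) gs
    × sumℚ (map proj₂ gs) ≡ 1ℚ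
    × (∀ u → x u ≡ sumℚ (map (λ p → proj₂ p * η (proj₁ p) u) gs))

𝔽 : ∀ n → Point n → Set
𝔽 n = InConv {n} Acyclic

IsFaceOf𝔽 : ∀ {n} → (Point n → Set) → Set
IsFaceOf𝔽 {n} P =
  ∃ λ (c : Point n) → ∃ λ (d : ℚ) →
    (∀ x → 𝔽 n x → c · x ≤ d)
    × (∀ x → P x → 𝔽 n x × c · x ≡ d)
    × (∀ x → 𝔽 n x → c · x ≡ d → P x)

AffinelyIndependent : ∀ {n k} → (Fin k → Point n) → Set
AffinelyIndependent {n} {k} xs =
  ∀ (l : Fin k → ℚ) →
    sumFin l ≡ 0ℚ →
    (∀ u → sumFin (λ i → l i * xs i u) ≡ 0ℚ) →
    ∀ i → l i ≡ 0ℚ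

HasDim : ∀ {n} → (Point n → Set) → ℕ → Set
HasDim {n} P d =
  (∃ λ (xs : Fin (suc d) → Point n) → (∀ i → P (xs i)) × AffinelyIndependent xs)
  × (∀ (xs : Fin (suc (suc d)) → Point n) → (∀ i → P (xs i)) → ¬ AffinelyIndependent xs)

IsFacetOf𝔽 : ∀ {n} → (Point n → Set) → Set
IsFacetOf𝔽 {n} P = IsFaceOf𝔽 P × ∃ λ d → HasDim (𝔽 n) (suc d) × HasDim P d

IsFacetSet : ∀ {n} → (Graph n → Set) → Set
IsFacetSet 𝒢 = (∀ G → 𝒢 G → Acyclic G) × IsFacetOf𝔽 (InConv 𝒢)

-- The facet is 𝔽 ∩ {c · x = d} for an inequality c · x ≤ d valid on 𝔽.  The empty graph
-- has η = 0 and is not on the facet, so d ≠ 0.  If no G ∈ 𝒢 had pa_G(a) = B, the whole facet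
-- would lie in the coordinate hyperplane x(a|B) = 0, and then η of the graph whose only family
-- is (a|B), the origin, and an affine basis of the facet would be affinely independent points of
-- 𝔽, one more than dim 𝔽 allows.  So every (a|B) is realised in 𝒢; removing parents of a from
-- such a graph keeps it acyclic, hence c · η ≤ d shows that c(a|B) grows with B (with c(a|∅) = 0).
-- Summing over the families, c · η_H ≥ c · η_G = d for every DAG H ⊇ G ∈ 𝒢, so η_H lies on the
-- facet, and as every η_H is a vertex of 𝔽, H ∈ 𝒢.
module Submission where

open import Defs
open import Data.Nat as ℕ using (ℕ; zero; suc)
open import Data.Fin as Fin using (Fin; zero; suc)
import Data.Fin.Properties as Fin
open import Data.Fin.Subset using (Subset; _∈_; _∉_; _⊆_; ⊥)
import Data.Fin.Subset.Properties as Subset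
open import Data.Bool using (true; false; T; not; if_then_else_)
import Data.Bool.Properties as Bool
open import Data.Rational as ℚ using (ℚ; 0ℚ; 1ℚ; _+_; _*_; -_; _≤_)
import Data.Rational.Properties as ℚ
open import Data.Rational.Solver using (module +-*-Solver)
open import Data.Product using (∃; _×_; _,_; proj₁; proj₂)
open import Data.Sum using (_⊎_; inj₁; inj₂)
open import Data.Empty using (⊥-elim)
open import Data.List using (List; []; _∷_; _++_; map; allFin)
import Data.List.Properties as List
open import Data.List.Relation.Unary.All as All using (All; []; _∷_)
import Data.List.Relation.Unary.All.Properties as All
open import Data.List.Relation.Unary.Any as Any using (here; there)
open import Data.List.Membership.Propositional using () renaming (_∈_ to _∈ₗ_)
open import Data.List.Membership.Propositional.Properties using (∈-allFin)
open import Data.Vec as Vec using (Vec; []; _∷_; lookup; tabulate)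
import Data.Vec.Properties as Vec
import Data.Vec.Functional as Vector
open import Function using (_∘_; Equivalence)
open import Relation.Nullary using (¬_; Dec; yes; no; does; contradiction)
open import Relation.Nullary.Decidable as Dec using (T?)
open import Relation.Binary.PropositionalEquality
open import Relation.Binary.Construct.Closure.Transitive using (TransClosure; [_]; _∷_)

open +-*-Solver using (solve; _:+_; _:*_; :-_; _:=_; con)

private
  variable
    A : Set
    n k : ℕ

p<p+1 : ∀ p → p ℚ.< p + 1ℚ
p<p+1 p = begin-strict
  p       ≡⟨ ℚ.+-identityʳ p ⟨
  p + 0ℚ  <⟨ ℚ.+-monoʳ-< p (ℚ.positive⁻¹ 1ℚ) ⟩
  p + 1ℚ  ∎
  where open ℚ.≤-Reasoning

p+1≰p : ∀ p → ¬ (p + 1ℚ ≤ p)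
p+1≰p p = ℚ.<-irrefl refl ∘ ℚ.<-≤-trans (p<p+1 p)

p*q≡0⇒q≡0 : ∀ {p q} → p ≢ 0ℚ → p * q ≡ 0ℚ → q ≡ 0ℚ
p*q≡0⇒q≡0 {p} {q} p≢0 p*q≡0 = begin
  q                 ≡⟨ ℚ.*-identityˡ q ⟨
  1ℚ * q            ≡⟨ cong (_* q) (ℚ.*-inverseˡ p) ⟨
  ℚ.1/ p * p * q    ≡⟨ ℚ.*-assoc (ℚ.1/ p) p q ⟩
  ℚ.1/ p * (p * q)  ≡⟨ cong (ℚ.1/ p *_) p*q≡0 ⟩
  ℚ.1/ p * 0ℚ       ≡⟨ ℚ.*-zeroʳ (ℚ.1/ p) ⟩
  0ℚ                ∎
  where
  open ≡-Reasoning
  instance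
    p-nonZero : ℚ.NonZero p
    p-nonZero = ℚ.≢-nonZero p≢0

+-cancelˡ-≤ : ∀ s {x y} → s + x ≤ s + y → x ≤ y
+-cancelˡ-≤ s {x} {y} s+x≤s+y = begin
  x              ≡⟨ solve 2 (λ s x → x := :- s :+ (s :+ x)) refl s x ⟩
  - s + (s + x)  ≤⟨ ℚ.+-monoʳ-≤ (- s) s+x≤s+y ⟩
  - s + (s + y)  ≡⟨ solve 2 (λ s y → :- s :+ (s :+ y) := y) refl s y ⟩
  y              ∎
  where open ℚ.≤-Reasoning

∑ : List A → (A → ℚ) → ℚ
∑ xs f = sumℚ (map f xs)

∑-cong : ∀ xs {f g : A → ℚ} → (∀ x → f x ≡ g x) → ∑ xs f ≡ ∑ xs g
∑-cong []       f≗g = refl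
∑-cong (x ∷ xs) f≗g = cong₂ _+_ (f≗g x) (∑-cong xs f≗g)

∑-+ : ∀ xs (f g : A → ℚ) → ∑ xs (λ x → f x + g x) ≡ ∑ xs f + ∑ xs g
∑-+ []       f g = refl
∑-+ (x ∷ xs) f g = trans (cong (f x + g x +_) (∑-+ xs f g))
  (solve 4 (λ a b c d → a :+ b :+ (c :+ d) := a :+ c :+ (b :+ d)) refl (f x) (g x) (∑ xs f) (∑ xs g))

∑-*ˡ : ∀ xs (k : ℚ) (f : A → ℚ) → ∑ xs (λ x → k * f x) ≡ k * ∑ xs f
∑-*ˡ []       k f = sym (ℚ.*-zeroʳ k)
∑-*ˡ (x ∷ xs) k f = trans (cong (k * f x +_) (∑-*ˡ xs k f)) (sym (ℚ.*-distribˡ-+ k (f x) _))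

∑-zero : ∀ {xs} {f : A → ℚ} → All (λ x → f x ≡ 0ℚ) xs → ∑ xs f ≡ 0ℚ
∑-zero []           = refl
∑-zero (fx≡0 ∷ f≡0) = cong₂ _+_ fx≡0 (∑-zero f≡0)

∑-mono-≤ : ∀ {xs} {f g : A → ℚ} → All (λ x → f x ≤ g x) xs → ∑ xs f ≤ ∑ xs g
∑-mono-≤ []           = ℚ.≤-refl
∑-mono-≤ (fx≤gx ∷ f≤g) = ℚ.+-mono-≤ fx≤gx (∑-mono-≤ f≤g)

∑-++ : ∀ xs ys (f : A → ℚ) → ∑ (xs ++ ys) f ≡ ∑ xs f + ∑ ys f
∑-++ []       ys f = sym (ℚ.+-identityˡ _)
∑-++ (x ∷ xs) ys f = trans (cong (f x +_) (∑-++ xs ys f)) (sym (ℚ.+-assoc (f x) _ _))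

∑-map : ∀ {B : Set} xs (g : A → B) (f : B → ℚ) → ∑ (map g xs) f ≡ ∑ xs (f ∘ g)
∑-map xs g f = cong sumℚ (sym (List.map-∘ xs))

∑-mono-+1 : ∀ {xs} {f g : A → ℚ} {x₀} → All (λ x → f x ≤ g x) xs → x₀ ∈ₗ xs → f x₀ + 1ℚ ≤ g x₀ →
            ∑ xs f + 1ℚ ≤ ∑ xs g
∑-mono-+1 {xs = x ∷ xs} {f} {g} (_ ∷ f≤g) (here refl) fx+1≤gx = begin
  f x + ∑ xs f + 1ℚ   ≡⟨ solve 3 (λ a b o → a :+ b :+ o := a :+ o :+ b) refl (f x) (∑ xs f) 1ℚ ⟩
  f x + 1ℚ + ∑ xs f   ≤⟨ ℚ.+-mono-≤ fx+1≤gx (∑-mono-≤ f≤g) ⟩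
  g x + ∑ xs g        ∎
  where open ℚ.≤-Reasoning
∑-mono-+1 {xs = x ∷ xs} {f} {g} (fx≤gx ∷ f≤g) (there x₀∈xs) fx₀+1≤gx₀ = begin
  f x + ∑ xs f + 1ℚ   ≡⟨ ℚ.+-assoc (f x) (∑ xs f) 1ℚ ⟩
  f x + (∑ xs f + 1ℚ) ≤⟨ ℚ.+-mono-≤ fx≤gx (∑-mono-+1 f≤g x₀∈xs fx₀+1≤gx₀) ⟩
  g x + ∑ xs g        ∎
  where open ℚ.≤-Reasoning

∑-convex-≤ : ∀ {xs} {w f : A → ℚ} {t} → All (λ x → 0ℚ ≤ w x) xs → ∑ xs w ≡ 1ℚ →
             All (λ x → f x ≤ t) xs → ∑ xs (λ x → w x * f x) ≤ t
∑-convex-≤ {xs = xs} {w} {f} {t} w≥0 ∑w≡1 f≤t = begin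
  ∑ xs (λ x → w x * f x) ≤⟨ ∑-mono-≤ (All.zipWith wf≤wt (w≥0 , f≤t)) ⟩
  ∑ xs (λ x → t * w x)   ≡⟨ ∑-*ˡ xs t w ⟩
  t * ∑ xs w             ≡⟨ cong (t *_) ∑w≡1 ⟩
  t * 1ℚ                 ≡⟨ ℚ.*-identityʳ t ⟩
  t                      ∎
  where
  open ℚ.≤-Reasoning
  wf≤wt : ∀ {x} → 0ℚ ≤ w x × f x ≤ t → w x * f x ≤ t * w x
  wf≤wt {x} (wx≥0 , fx≤t) =
    ℚ.≤-trans (ℚ.*-monoˡ-≤-nonNeg (w x) {{ℚ.nonNegative wx≥0}} fx≤t) (ℚ.≤-reflexive (ℚ.*-comm (w x) t))

sumFin-suc : (f : Fin (suc k) → ℚ) → sumFin f ≡ f zero + sumFin (f ∘ suc)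
sumFin-suc f = cong (λ fs → f zero + sumℚ fs)
  (trans (List.map-tabulate suc f) (sym (List.map-tabulate (λ i → i) (f ∘ suc))))

sumFin-swap : ∀ (f g : Fin k → ℚ) a → (∀ i → i ≢ a → f i ≡ g i) → sumFin f + g a ≡ sumFin g + f a
sumFin-swap {suc k} f g zero f≡g = begin
  sumFin f + g zero                  ≡⟨ cong (_+ g zero) (sumFin-suc f) ⟩
  f zero + sumFin (f ∘ suc) + g zero ≡⟨ cong (λ s → f zero + s + g zero) (∑-cong (allFin k) (λ i → f≡g (suc i) λ ()))  ⟩
  f zero + sumFin (g ∘ suc) + g zero ≡⟨ solve 3 (λ x y s → x :+ s :+ y := y :+ s :+ x) refl (f zero) (g zero) _ ⟩
  g zero + sumFin (g ∘ suc) + f zero ≡⟨ cong (_+ f zero) (sumFin-suc g) ⟨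
  sumFin g + f zero                  ∎
  where open ≡-Reasoning
sumFin-swap {suc k} f g (suc a) f≡g = begin
  sumFin f + g (suc a)                    ≡⟨ cong (_+ g (suc a)) (sumFin-suc f) ⟩
  f zero + sumFin (f ∘ suc) + g (suc a)   ≡⟨ ℚ.+-assoc (f zero) _ _ ⟩
  f zero + (sumFin (f ∘ suc) + g (suc a)) ≡⟨ cong₂ _+_ (f≡g zero λ ()) (sumFin-swap (f ∘ suc) (g ∘ suc) a (λ i i≢a → f≡g (suc i) (i≢a ∘ Fin.suc-injective))) ⟩
  g zero + (sumFin (g ∘ suc) + f (suc a)) ≡⟨ ℚ.+-assoc (g zero) _ _ ⟨
  g zero + sumFin (g ∘ suc) + f (suc a)   ≡⟨ cong (_+ f (suc a)) (sumFin-suc g) ⟨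
  sumFin g + f (suc a)                    ∎
  where open ≡-Reasoning

sumFin-≤-at : ∀ (f g : Fin k → ℚ) a → (∀ i → i ≢ a → f i ≡ g i) → sumFin f ≤ sumFin g → f a ≤ g a
sumFin-≤-at f g a f≡g ∑f≤∑g = +-cancelˡ-≤ (sumFin g) (begin
  sumFin g + f a  ≡⟨ sumFin-swap f g a f≡g ⟨
  sumFin f + g a  ≤⟨ ℚ.+-monoˡ-≤ (g a) ∑f≤∑g ⟩
  sumFin g + g a  ∎)
  where open ℚ.≤-Reasoning

lookup≡false : ∀ {a : Fin n} {B : Subset n} → a ∉ B → lookup B a ≡ false
lookup≡false {a = a} {B} a∉B with lookup B a in eq
... | true  = contradiction (Vec.lookup⇒[]= a B eq) a∉B
... | false = refl

¬nonempty⇒≡⊥ : ∀ {B : Subset n} → ¬ T (nonemptyᵇ B) → B ≡ ⊥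
¬nonempty⇒≡⊥ {B = []}        _     = refl
¬nonempty⇒≡⊥ {B = true ∷ B}  empty = contradiction _ empty
¬nonempty⇒≡⊥ {B = false ∷ B} empty = cong (false ∷_) (¬nonempty⇒≡⊥ empty)

¬nonempty-⊥ : ∀ n → ¬ T (nonemptyᵇ (⊥ {n}))
¬nonempty-⊥ (suc n) = ¬nonempty-⊥ n

¬isΥ-⊥ : ∀ (a : Fin n) → ¬ T (isΥ a ⊥)
¬isΥ-⊥ {n} a = ¬nonempty-⊥ n ∘ proj₁ ∘ Equivalence.to (Bool.T-∧ {nonemptyᵇ (⊥ {n})})

isΥ⇒∉ : ∀ {a : Fin n} {B : Subset n} → T (isΥ a B) → a ∉ B
isΥ⇒∉ {B = B} p a∈B = subst (T ∘ not) (Vec.[]=⇒lookup a∈B) (proj₂ (Equivalence.to (Bool.T-∧ {nonemptyᵇ B}) p))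

isΥ-or-⊥ : ∀ {a : Fin n} {B : Subset n} → a ∉ B → T (isΥ a B) ⊎ B ≡ ⊥
isΥ-or-⊥ {a = a} {B} a∉B with T? (isΥ a B)
... | yes p = inj₁ p
... | no ¬p = inj₂ (¬nonempty⇒≡⊥ λ ne → ¬p (Equivalence.from Bool.T-∧ (ne , Equivalence.from Bool.T-not-≡ (lookup≡false a∉B))))

-- c(a|B), extended by 0 to the pairs outside Υ (in particular c(a|∅) = 0).
coef : Point n → Fin n → Subset n → ℚ
coef c a B with T? (isΥ a B)
... | yes p = c ((a , B) , p)
... | no _  = 0ℚ

-- The summand of sumΥ is a local function of Defs and cannot be named; its
-- instance is fixed by unification in sumΥ-unfold, whose proof comes first.
sumΥ-summand≡coef : ∀ (f : Υ n → ℚ) a B → _ ≡ coef f a B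

sumΥ-unfold : ∀ (f : Υ n → ℚ) → sumΥ f ≡ sumFin (λ a → ∑ (allSubsets n) (coef f a))
sumΥ-unfold {n} f = ∑-cong (allFin n) λ a → ∑-cong (allSubsets n) (sumΥ-summand≡coef f a)

sumΥ-summand≡coef f a B with T? (isΥ a B)
... | yes _ = refl
... | no _  = refl

module _ {n} (a : Fin n) (B : Subset n) where

  coef-Υ : ∀ (c : Point n) (p : T (isΥ a B)) → coef c a B ≡ c ((a , B) , p)
  coef-Υ c p with T? (isΥ a B)
  ... | yes q = cong (λ r → c ((a , B) , r)) (Bool.T-irrelevant q p)
  ... | no ¬p = contradiction p ¬p

  coef-¬Υ : ∀ (c : Point n) → ¬ T (isΥ a B) → coef c a B ≡ 0ℚ
  coef-¬Υ c ¬p with T? (isΥ a B)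
  ... | yes p = contradiction p ¬p
  ... | no _  = refl

  coef-cong : ∀ {f g : Point n} → (∀ u → f u ≡ g u) → coef f a B ≡ coef g a B
  coef-cong f≗g with T? (isΥ a B)
  ... | yes _ = f≗g _
  ... | no _  = refl

  coef-+ : ∀ (f g : Point n) → coef (λ u → f u + g u) a B ≡ coef f a B + coef g a B
  coef-+ f g with T? (isΥ a B)
  ... | yes _ = refl
  ... | no _  = refl

  coef-*ˡ : ∀ (k : ℚ) (f : Point n) → coef (λ u → k * f u) a B ≡ k * coef f a B
  coef-*ˡ k f with T? (isΥ a B)
  ... | yes _ = refl
  ... | no _  = sym (ℚ.*-zeroʳ k)

coef-⊥ : ∀ (a : Fin n) (c : Point n) → coef c a ⊥ ≡ 0ℚ
coef-⊥ a c = coef-¬Υ a ⊥ c (¬isΥ-⊥ a)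

sumΥ-cong : ∀ {f g : Point n} → (∀ u → f u ≡ g u) → sumΥ f ≡ sumΥ g
sumΥ-cong {n} {f} {g} f≗g = begin
  sumΥ f                                         ≡⟨ sumΥ-unfold f ⟩
  sumFin (λ a → ∑ (allSubsets n) (coef f a))     ≡⟨ ∑-cong (allFin n) (λ a → ∑-cong (allSubsets n) λ B → coef-cong a B f≗g) ⟩
  sumFin (λ a → ∑ (allSubsets n) (coef g a))     ≡⟨ sumΥ-unfold g ⟨
  sumΥ g                                         ∎
  where open ≡-Reasoning

sumΥ-+ : ∀ (f g : Point n) → sumΥ (λ u → f u + g u) ≡ sumΥ f + sumΥ g
sumΥ-+ {n} f g = begin
  sumΥ (λ u → f u + g u)
    ≡⟨ sumΥ-unfold (λ u → f u + g u) ⟩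
  sumFin (λ a → ∑ (allSubsets n) (coef (λ u → f u + g u) a))
    ≡⟨ ∑-cong (allFin n) (λ a → trans (∑-cong (allSubsets n) λ B → coef-+ a B f g) (∑-+ (allSubsets n) _ _)) ⟩
  sumFin (λ a → ∑ (allSubsets n) (coef f a) + ∑ (allSubsets n) (coef g a))
    ≡⟨ ∑-+ (allFin n) _ _ ⟩
  sumFin (λ a → ∑ (allSubsets n) (coef f a)) + sumFin (λ a → ∑ (allSubsets n) (coef g a))
    ≡⟨ cong₂ _+_ (sumΥ-unfold f) (sumΥ-unfold g) ⟨
  sumΥ f + sumΥ g
    ∎
  where open ≡-Reasoning

sumΥ-*ˡ : ∀ (k : ℚ) (f : Point n) → sumΥ (λ u → k * f u) ≡ k * sumΥ f
sumΥ-*ˡ {n} k f = begin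
  sumΥ (λ u → k * f u)
    ≡⟨ sumΥ-unfold (λ u → k * f u) ⟩
  sumFin (λ a → ∑ (allSubsets n) (coef (λ u → k * f u) a))
    ≡⟨ ∑-cong (allFin n) (λ a → trans (∑-cong (allSubsets n) λ B → coef-*ˡ a B k f) (∑-*ˡ (allSubsets n) k _)) ⟩
  sumFin (λ a → k * ∑ (allSubsets n) (coef f a))
    ≡⟨ ∑-*ˡ (allFin n) k _ ⟩
  k * sumFin (λ a → ∑ (allSubsets n) (coef f a))
    ≡⟨ cong (k *_) (sumΥ-unfold f) ⟨
  k * sumΥ f
    ∎
  where open ≡-Reasoning

sumΥ-zero : ∀ {f : Point n} → (∀ u → f u ≡ 0ℚ) → sumΥ f ≡ 0ℚ
sumΥ-zero {n} {f} f≡0 = begin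
  sumΥ f                 ≡⟨ sumΥ-cong {n} (λ u → trans (f≡0 u) (sym (ℚ.*-zeroˡ (f u)))) ⟩
  sumΥ (λ u → 0ℚ * f u)  ≡⟨ sumΥ-*ˡ 0ℚ f ⟩
  0ℚ * sumΥ f            ≡⟨ ℚ.*-zeroˡ (sumΥ f) ⟩
  0ℚ                     ∎
  where open ≡-Reasoning

sumΥ-∑ : ∀ xs (F : A → Point n) → sumΥ (λ u → ∑ xs (λ x → F x u)) ≡ ∑ xs (λ x → sumΥ (F x))
sumΥ-∑ {n = n} []       F = sumΥ-zero {n} (λ _ → refl)
sumΥ-∑ (x ∷ xs) F = trans (sumΥ-+ (F x) _) (cong (sumΥ (F x) +_) (sumΥ-∑ xs F))

·-zero : ∀ (c x : Point n) → (∀ u → x u ≡ 0ℚ) → c · x ≡ 0ℚ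
·-zero c x x≡0 = sumΥ-zero (λ u → trans (cong (c u *_) (x≡0 u)) (ℚ.*-zeroʳ (c u)))

·-∑ : ∀ (c : Point n) xs (w : A → ℚ) (F : A → Point n) {x : Point n} →
      (∀ u → x u ≡ ∑ xs (λ p → w p * F p u)) → c · x ≡ ∑ xs (λ p → w p * (c · F p))
·-∑ {n} c xs w F {x} x≡∑ = begin
  sumΥ (λ u → c u * x u)                              ≡⟨ sumΥ-cong {n} c*x≡∑ ⟩
  sumΥ (λ u → ∑ xs (λ p → w p * (c u * F p u)))       ≡⟨ sumΥ-∑ xs (λ p u → w p * (c u * F p u)) ⟩
  ∑ xs (λ p → sumΥ (λ u → w p * (c u * F p u)))       ≡⟨ ∑-cong xs (λ p → sumΥ-*ˡ (w p) (λ u → c u * F p u)) ⟩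
  ∑ xs (λ p → w p * (c · F p))                        ∎
  where
  open ≡-Reasoning
  c*x≡∑ : ∀ u → c u * x u ≡ ∑ xs (λ p → w p * (c u * F p u))
  c*x≡∑ u = begin
    c u * x u                             ≡⟨ cong (c u *_) (x≡∑ u) ⟩
    c u * ∑ xs (λ p → w p * F p u)        ≡⟨ ∑-*ˡ xs (c u) _ ⟨
    ∑ xs (λ p → c u * (w p * F p u))      ≡⟨ ∑-cong xs (λ p → solve 3 (λ a b f → a :* (b :* f) := b :* (a :* f)) refl (c u) (w p) (F p u)) ⟩
    ∑ xs (λ p → w p * (c u * F p u))      ∎

∑-allSubsets-suc : ∀ n (f : Subset (suc n) → ℚ) →
                   ∑ (allSubsets (suc n)) f ≡ ∑ (allSubsets n) (f ∘ (true ∷_)) + ∑ (allSubsets n) (f ∘ (false ∷_))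
∑-allSubsets-suc n f = trans (∑-++ (map (true ∷_) (allSubsets n)) _ f)
  (cong₂ _+_ (∑-map (allSubsets n) (true ∷_) f) (∑-map (allSubsets n) (false ∷_) f))

∑-indicator : ∀ n (S : Subset n) (h : Subset n → ℚ) →
              ∑ (allSubsets n) (λ B → if does (S ≟S B) then h B else 0ℚ) ≡ h S
∑-indicator zero    []          h = ℚ.+-identityʳ (h [])
∑-indicator (suc n) (true ∷ S)  h = begin
  ∑ (allSubsets (suc n)) δ
    ≡⟨ ∑-allSubsets-suc n δ ⟩
  ∑ (allSubsets n) (δ ∘ (true ∷_)) + ∑ (allSubsets n) (δ ∘ (false ∷_))
    ≡⟨ cong₂ _+_ (∑-indicator n S (h ∘ (true ∷_))) (∑-zero (All.universal (λ _ → refl) (allSubsets n))) ⟩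
  h (true ∷ S) + 0ℚ
    ≡⟨ ℚ.+-identityʳ _ ⟩
  h (true ∷ S)
    ∎
  where
  open ≡-Reasoning
  δ : Subset (suc n) → ℚ
  δ B = if does ((true ∷ S) ≟S B) then h B else 0ℚ
∑-indicator (suc n) (false ∷ S) h = begin
  ∑ (allSubsets (suc n)) δ
    ≡⟨ ∑-allSubsets-suc n δ ⟩
  ∑ (allSubsets n) (δ ∘ (true ∷_)) + ∑ (allSubsets n) (δ ∘ (false ∷_))
    ≡⟨ cong₂ _+_ (∑-zero (All.universal (λ _ → refl) (allSubsets n))) (∑-indicator n S (h ∘ (false ∷_))) ⟩
  0ℚ + h (false ∷ S)
    ≡⟨ ℚ.+-identityˡ _ ⟩
  h (false ∷ S)
    ∎
  where
  open ≡-Reasoning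
  δ : Subset (suc n) → ℚ
  δ B = if does ((false ∷ S) ≟S B) then h B else 0ℚ

coef-*η : ∀ (c : Point n) K a B → coef (λ u → c u * η K u) a B ≡ (if does (pa K a ≟S B) then coef c a B else 0ℚ)
coef-*η c K a B with T? (isΥ a B)
... | no _  = sym (Bool.if-eta (does (pa K a ≟S B)))
... | yes p with pa K a ≟S B
...   | yes _ = ℚ.*-identityʳ (c ((a , B) , p))
...   | no _  = ℚ.*-zeroʳ (c ((a , B) , p))

·-η : ∀ (c : Point n) K → c · η K ≡ sumFin (λ a → coef c a (pa K a))
·-η {n} c K = trans (sumΥ-unfold (λ u → c u * η K u)) (∑-cong (allFin n) λ a → begin
  ∑ (allSubsets n) (coef (λ u → c u * η K u) a)                          ≡⟨ ∑-cong (allSubsets n) (coef-*η c K a) ⟩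
  ∑ (allSubsets n) (λ B → if does (pa K a ≟S B) then coef c a B else 0ℚ)  ≡⟨ ∑-indicator n (pa K a) (coef c a) ⟩
  coef c a (pa K a)                                                      ∎)
  where open ≡-Reasoning

lookup-ext : ∀ {xs ys : Vec A k} → (∀ i → lookup xs i ≡ lookup ys i) → xs ≡ ys
lookup-ext {xs = xs} {ys} xs≗ys = begin
  xs                ≡⟨ Vec.tabulate∘lookup xs ⟨
  tabulate (lookup xs) ≡⟨ Vec.tabulate-cong xs≗ys ⟩
  tabulate (lookup ys) ≡⟨ Vec.tabulate∘lookup ys ⟩
  ys                ∎
  where open ≡-Reasoning

module _ (G : Graph n) (a b : Fin n) where

  lookup-pa : lookup (pa G a) b ≡ lookup (lookup G b) a
  lookup-pa = Vec.lookup∘tabulate (λ b → lookup (lookup G b) a) b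

  Edge⇒∈pa : Edge G b a → b ∈ pa G a
  Edge⇒∈pa e = Vec.lookup⇒[]= b (pa G a) (trans lookup-pa (Equivalence.to Bool.T-≡ e))

  ∈pa⇒Edge : b ∈ pa G a → Edge G b a
  ∈pa⇒Edge b∈pa = Equivalence.from Bool.T-≡ (trans (sym lookup-pa) (Vec.[]=⇒lookup b∈pa))

pa-mono : ∀ (G H : Graph n) → G ⊆G H → ∀ a → pa G a ⊆ pa H a
pa-mono G H G⊆H a {b} = Edge⇒∈pa H a b ∘ G⊆H b a ∘ ∈pa⇒Edge G a b

Acyclic⇒∉pa : ∀ (G : Graph n) → Acyclic G → ∀ a → a ∉ pa G a
Acyclic⇒∉pa G acyclic a = acyclic a ∘ [_] ∘ ∈pa⇒Edge G a a

pa-injective : ∀ (G H : Graph n) → (∀ a → pa G a ≡ pa H a) → G ≡ H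
pa-injective G H pa≡ = lookup-ext λ b → lookup-ext λ a → begin
  lookup (lookup G b) a ≡⟨ lookup-pa G a b ⟨
  lookup (pa G a) b     ≡⟨ cong (λ P → lookup P b) (pa≡ a) ⟩
  lookup (pa H a) b     ≡⟨ lookup-pa H a b ⟩
  lookup (lookup H b) a ∎
  where open ≡-Reasoning

_≟G_ : (G H : Graph n) → Dec (G ≡ H)
_≟G_ = Vec.≡-dec _≟S_

fromParents : (Fin n → Subset n) → Graph n
fromParents P = tabulate λ b → tabulate λ a → lookup (P a) b

pa-fromParents : ∀ (P : Fin n → Subset n) a → pa (fromParents P) a ≡ P a
pa-fromParents P a = trans (Vec.tabulate-cong λ b → begin
  lookup (lookup (fromParents P) b) a          ≡⟨ cong (λ row → lookup row a) (Vec.lookup∘tabulate _ b) ⟩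
  lookup (tabulate λ a → lookup (P a) b) a     ≡⟨ Vec.lookup∘tabulate _ a ⟩
  lookup (P a) b                               ∎) (Vec.tabulate∘lookup (P a))
  where open ≡-Reasoning

withParents : Graph n → Fin n → Subset n → Graph n
withParents K a D = fromParents λ a′ → if does (a′ Fin.≟ a) then D else pa K a′

module _ (K : Graph n) (a : Fin n) (D : Subset n) where

  private
    P : Fin n → Subset n
    P a′ = if does (a′ Fin.≟ a) then D else pa K a′

  pa-withParents-≡ : pa (withParents K a D) a ≡ D
  pa-withParents-≡ = trans (pa-fromParents P a) (cong (if_then D else pa K a) (Dec.dec-true (a Fin.≟ a) refl))

  pa-withParents-≢ : ∀ {a′} → a′ ≢ a → pa (withParents K a D) a′ ≡ pa K a′
  pa-withParents-≢ {a′} a′≢a = trans (pa-fromParents P a′) (cong (if_then D else pa K a′) (Dec.dec-false (a′ Fin.≟ a) a′≢a))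

  ∈pa-withParents : ∀ {b a′} → b ∈ pa (withParents K a D) a′ → (a′ ≡ a × b ∈ D) ⊎ (a′ ≢ a × b ∈ pa K a′)
  ∈pa-withParents {b} {a′} b∈pa with a′ Fin.≟ a
  ... | yes refl = inj₁ (refl , subst (b ∈_) pa-withParents-≡ b∈pa)
  ... | no a′≢a  = inj₂ (a′≢a , subst (b ∈_) (pa-withParents-≢ a′≢a) b∈pa)

  withParents-⊆G : D ⊆ pa K a → withParents K a D ⊆G K
  withParents-⊆G D⊆pa b a′ e with ∈pa-withParents {b} {a′} (Edge⇒∈pa (withParents K a D) a′ b e)
  ... | inj₁ (refl , b∈D) = ∈pa⇒Edge K a b (D⊆pa b∈D)
  ... | inj₂ (_ , b∈pa)   = ∈pa⇒Edge K a′ b b∈pa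

pa-emptyGraph : ∀ (a : Fin n) → pa (emptyGraph n) a ≡ ⊥
pa-emptyGraph {n} a = lookup-ext λ b → begin
  lookup (pa (emptyGraph n) a) b     ≡⟨ lookup-pa (emptyGraph n) a b ⟩
  lookup (lookup (emptyGraph n) b) a ≡⟨ cong (λ row → lookup row a) (Vec.lookup-replicate b _) ⟩
  lookup (Vec.replicate n false) a   ≡⟨ Vec.lookup-replicate a false ⟩
  false                              ≡⟨ Vec.lookup-replicate b false ⟨
  lookup ⊥ b                         ∎
  where open ≡-Reasoning

¬Edge-emptyGraph : ∀ (b a : Fin n) → ¬ Edge (emptyGraph n) b a
¬Edge-emptyGraph {n} b a = Subset.∉⊥ ∘ subst (b ∈_) (pa-emptyGraph a) ∘ Edge⇒∈pa (emptyGraph n) a b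

⊆G-acyclic : ∀ (G H : Graph n) → G ⊆G H → Acyclic H → Acyclic G
⊆G-acyclic G H G⊆H H-acyclic a = H-acyclic a ∘ walk
  where
  walk : ∀ {x y} → TransClosure (Edge G) x y → TransClosure (Edge H) x y
  walk [ e ]   = [ G⊆H _ _ e ]
  walk (e ∷ w) = G⊆H _ _ e ∷ walk w

emptyGraph-acyclic : Acyclic (emptyGraph n)
emptyGraph-acyclic a [ e ]   = ¬Edge-emptyGraph a a e
emptyGraph-acyclic a (e ∷ _) = ¬Edge-emptyGraph a _ e

star-acyclic : ∀ (G : Graph n) a → (∀ x y → Edge G x y → y ≡ a × x ≢ a) → Acyclic G
star-acyclic G a into-a x walk = proj₂ (into-a x _ (proj₂ (firstEdge walk))) (proj₁ (into-a _ x (proj₂ (lastEdge walk))))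
  where
  firstEdge : ∀ {x y} → TransClosure (Edge G) x y → ∃ (Edge G x)
  firstEdge [ e ]   = _ , e
  firstEdge (e ∷ _) = _ , e
  lastEdge : ∀ {x y} → TransClosure (Edge G) x y → ∃ λ z → Edge G z y
  lastEdge [ e ]   = _ , e
  lastEdge (_ ∷ w) = lastEdge w

familyGraph : Fin n → Subset n → Graph n
familyGraph {n} a B = withParents (emptyGraph n) a B

familyGraph-acyclic : ∀ {a : Fin n} {B} → a ∉ B → Acyclic (familyGraph a B)
familyGraph-acyclic {n} {a} {B} a∉B = star-acyclic (familyGraph a B) a into-a
  where
  into-a : ∀ x y → Edge (familyGraph a B) x y → y ≡ a × x ≢ a
  into-a x y e with ∈pa-withParents (emptyGraph n) a B (Edge⇒∈pa (familyGraph a B) y x e)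
  ... | inj₁ (y≡a , x∈B)  = y≡a , λ { refl → a∉B x∈B }
  ... | inj₂ (_ , x∈pa∅) = contradiction (∈pa⇒Edge (emptyGraph n) y x x∈pa∅) (¬Edge-emptyGraph x y)

module _ (G : Graph n) {a : Fin n} {B : Subset n} (p : T (isΥ a B)) where

  η-≡ : pa G a ≡ B → η G ((a , B) , p) ≡ 1ℚ
  η-≡ pa≡B = cong (if_then 1ℚ else 0ℚ) (Dec.dec-true (pa G a ≟S B) pa≡B)

  η-≢ : pa G a ≢ B → η G ((a , B) , p) ≡ 0ℚ
  η-≢ pa≢B = cong (if_then 1ℚ else 0ℚ) (Dec.dec-false (pa G a ≟S B) pa≢B)

η-emptyGraph : ∀ (u : Υ n) → η (emptyGraph n) u ≡ 0ℚ
η-emptyGraph {n} ((a , B) , p) = η-≢ (emptyGraph n) p λ pa≡B →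
  ¬isΥ-⊥ a (subst (T ∘ isΥ a) (trans (sym pa≡B) (pa-emptyGraph a)) p)

η∈InConv : ∀ {𝒫 : Graph n → Set} G → 𝒫 G → InConv 𝒫 (η G)
η∈InConv G 𝒫G =
  (G , 1ℚ) ∷ [] , (𝒫G , ℚ.nonNegative⁻¹ 1ℚ) ∷ [] , refl , λ u → sym (trans (ℚ.+-identityʳ _) (ℚ.*-identityˡ _))

InConv⇒parents : ∀ {𝒢 : Graph n → Set} {x : Point n} {a B} (p : T (isΥ a B)) →
                 InConv 𝒢 x → x ((a , B) , p) ≢ 0ℚ → ∃ λ G → 𝒢 G × pa G a ≡ B
InConv⇒parents {a = a} {B} p (gs , gs∈𝒢 , _ , x≡∑) x≢0 with Any.any? (λ q → pa (proj₁ q) a ≟S B) gs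
... | yes found = let ((𝒢G , _) , pa≡B) = All.lookupAny gs∈𝒢 found in _ , 𝒢G , pa≡B
... | no none    = contradiction (trans (x≡∑ _) (∑-zero (All.map (λ {q} → weighted-zero q) (All.¬Any⇒All¬ gs none)))) x≢0
  where
  weighted-zero : ∀ q → pa (proj₁ q) a ≢ B → proj₂ q * η (proj₁ q) ((a , B) , p) ≡ 0ℚ
  weighted-zero q pa≢B = trans (cong (proj₂ q *_) (η-≢ (proj₁ q) p pa≢B)) (ℚ.*-zeroʳ (proj₂ q))

-- 2η_H − 1: the linear functional exposing η_H as a vertex of 𝔽.
peak : Graph n → Point n
peak H ((a , B) , _) = if does (B ≟S pa H a) then 1ℚ else - 1ℚ

module _ (H : Graph n) where

  coef-peak-pa : ∀ a → T (isΥ a (pa H a)) → coef (peak H) a (pa H a) ≡ 1ℚ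
  coef-peak-pa a p = trans (coef-Υ a (pa H a) (peak H) p) (cong (if_then 1ℚ else - 1ℚ) (Dec.dec-true (pa H a ≟S pa H a) refl))

  coef-peak-≢ : ∀ a {B} → T (isΥ a B) → B ≢ pa H a → coef (peak H) a B ≡ - 1ℚ
  coef-peak-≢ a {B} p B≢pa = trans (coef-Υ a B (peak H) p) (cong (if_then 1ℚ else - 1ℚ) (Dec.dec-false (B ≟S pa H a) B≢pa))

  coef-peak-gap : ∀ a {B} → a ∉ pa H a → a ∉ B → B ≢ pa H a → coef (peak H) a B + 1ℚ ≤ coef (peak H) a (pa H a)
  coef-peak-gap a {B} a∉pa a∉B B≢pa with isΥ-or-⊥ a∉pa | isΥ-or-⊥ a∉B
  ... | inj₁ pH | inj₁ pB = begin
    coef (peak H) a B + 1ℚ    ≡⟨ cong (_+ 1ℚ) (coef-peak-≢ a pB B≢pa) ⟩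
    - 1ℚ + 1ℚ                 ≤⟨ ℚ.nonNegative⁻¹ 1ℚ ⟩
    1ℚ                        ≡⟨ coef-peak-pa a pH ⟨
    coef (peak H) a (pa H a)  ∎
    where open ℚ.≤-Reasoning
  ... | inj₁ pH | inj₂ refl = begin
    coef (peak H) a ⊥ + 1ℚ    ≡⟨ cong (_+ 1ℚ) (coef-⊥ a (peak H)) ⟩
    0ℚ + 1ℚ                   ≡⟨ coef-peak-pa a pH ⟨
    coef (peak H) a (pa H a)  ∎
    where open ℚ.≤-Reasoning
  ... | inj₂ pa≡⊥ | inj₁ pB = begin
    coef (peak H) a B + 1ℚ    ≡⟨ cong (_+ 1ℚ) (coef-peak-≢ a pB B≢pa) ⟩
    - 1ℚ + 1ℚ                 ≡⟨ coef-⊥ a (peak H) ⟨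
    coef (peak H) a ⊥         ≡⟨ cong (coef (peak H) a) pa≡⊥ ⟨
    coef (peak H) a (pa H a)  ∎
    where open ℚ.≤-Reasoning
  ... | inj₂ pa≡⊥ | inj₂ B≡⊥ = contradiction (trans B≡⊥ (sym pa≡⊥)) B≢pa

  coef-peak-≤ : ∀ a {B} → a ∉ pa H a → a ∉ B → coef (peak H) a B ≤ coef (peak H) a (pa H a)
  coef-peak-≤ a {B} a∉pa a∉B with B ≟S pa H a
  ... | yes B≡pa = ℚ.≤-reflexive (cong (coef (peak H) a) B≡pa)
  ... | no B≢pa  = ℚ.<⇒≤ (ℚ.<-≤-trans (p<p+1 _) (coef-peak-gap a a∉pa a∉B B≢pa))

  peak-gap : Acyclic H → ∀ K → Acyclic K → K ≢ H → peak H · η K + 1ℚ ≤ peak H · η H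
  peak-gap H-acyclic K K-acyclic K≢H = begin
    peak H · η K + 1ℚ                             ≡⟨ cong (_+ 1ℚ) (·-η (peak H) K) ⟩
    sumFin (λ a → coef (peak H) a (pa K a)) + 1ℚ  ≤⟨ ∑-mono-+1 (All.universal coef≤ (allFin n)) (∈-allFin a) coef+1≤ ⟩
    sumFin (λ a → coef (peak H) a (pa H a))       ≡⟨ ·-η (peak H) H ⟨
    peak H · η H                                  ∎
    where
    open ℚ.≤-Reasoning
    differing-parents : ∃ λ a → pa K a ≢ pa H a
    differing-parents = Fin.¬∀⟶∃¬ n _ (λ a → pa K a ≟S pa H a) (K≢H ∘ pa-injective K H)
    a : Fin n
    a = proj₁ differing-parents
    coef≤ : ∀ a → coef (peak H) a (pa K a) ≤ coef (peak H) a (pa H a)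
    coef≤ a = coef-peak-≤ a (Acyclic⇒∉pa H H-acyclic a) (Acyclic⇒∉pa K K-acyclic a)
    coef+1≤ : coef (peak H) a (pa K a) + 1ℚ ≤ coef (peak H) a (pa H a)
    coef+1≤ = coef-peak-gap a (Acyclic⇒∉pa H H-acyclic a) (Acyclic⇒∉pa K K-acyclic a) (proj₂ differing-parents)

η-vertex : ∀ {𝒢 : Graph n → Set} → (∀ G → 𝒢 G → Acyclic G) → ∀ H → Acyclic H → InConv 𝒢 (η H) → 𝒢 H
η-vertex {𝒢 = 𝒢} 𝒢-acyclic H H-acyclic (gs , gs∈𝒢 , ∑w≡1 , ηH≡∑) with Any.any? (λ q → proj₁ q ≟G H) gs
... | yes found = let ((𝒢G , _) , G≡H) = All.lookupAny gs∈𝒢 found in subst 𝒢 G≡H 𝒢G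
... | no absent = contradiction t+1≤t (p+1≰p t)
  where
  open ℚ.≤-Reasoning
  t : ℚ
  t = peak H · η H
  w s : Graph _ × ℚ → ℚ
  w = proj₂
  s q = peak H · η (proj₁ q)
  gaps : All (λ q → s q + 1ℚ ≤ t) gs
  gaps = All.zipWith (λ { ((𝒢G , _) , G≢H) → peak-gap H H-acyclic _ (𝒢-acyclic _ 𝒢G) G≢H })
                     (gs∈𝒢 , All.¬Any⇒All¬ gs absent)
  t+1≤t : t + 1ℚ ≤ t
  t+1≤t = begin
    t + 1ℚ                         ≡⟨ cong₂ _+_ (·-∑ (peak H) gs w (η ∘ proj₁) ηH≡∑) (sym ∑w≡1) ⟩
    ∑ gs (λ q → w q * s q) + ∑ gs w ≡⟨ ∑-+ gs _ w ⟨
    ∑ gs (λ q → w q * s q + w q)    ≡⟨ ∑-cong gs (λ q → solve 2 (λ w s → w :* s :+ w := w :* (s :+ con 1ℚ)) refl (w q) (s q)) ⟩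
    ∑ gs (λ q → w q * (s q + 1ℚ))   ≤⟨ ∑-convex-≤ (All.map proj₂ gs∈𝒢) ∑w≡1 gaps ⟩
    t                               ∎

module _ {y : Point n} {xs : Fin k → Point n} (xs-independent : AffinelyIndependent xs) where

  ∷-independent : (∀ l → sumFin l ≡ 0ℚ → (∀ u → sumFin (λ i → l i * (y Vector.∷ xs) i u) ≡ 0ℚ) → l zero ≡ 0ℚ) →
                  AffinelyIndependent (y Vector.∷ xs)
  ∷-independent head≡0 l ∑l≡0 ∑ly≡0 = λ { zero → l₀≡0 ; (suc i) → xs-independent (l ∘ suc) ∑l′≡0 ∑l′x≡0 i }
    where
    open ≡-Reasoning
    l₀≡0 : l zero ≡ 0ℚ
    l₀≡0 = head≡0 l ∑l≡0 ∑ly≡0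
    drop-head : ∀ {s} → l zero + s ≡ 0ℚ → s ≡ 0ℚ
    drop-head {s} l₀+s≡0 = begin
      s           ≡⟨ ℚ.+-identityˡ s ⟨
      0ℚ + s      ≡⟨ cong (_+ s) l₀≡0 ⟨
      l zero + s  ≡⟨ l₀+s≡0 ⟩
      0ℚ          ∎
    ∑l′≡0 : sumFin (l ∘ suc) ≡ 0ℚ
    ∑l′≡0 = drop-head (trans (sym (sumFin-suc l)) ∑l≡0)
    rest : Υ n → ℚ
    rest u = sumFin (λ i → l (suc i) * xs i u)
    ∑l′x≡0 : ∀ u → rest u ≡ 0ℚ
    ∑l′x≡0 u = drop-head (begin
      l zero + rest u                    ≡⟨ cong (_+ rest u) (trans l₀≡0 (sym (ℚ.*-zeroˡ (y u)))) ⟩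
      0ℚ * y u + rest u                  ≡⟨ cong (λ l₀ → l₀ * y u + rest u) l₀≡0 ⟨
      l zero * y u + rest u              ≡⟨ sumFin-suc (λ i → l i * (y Vector.∷ xs) i u) ⟨
      sumFin (λ i → l i * (y Vector.∷ xs) i u) ≡⟨ ∑ly≡0 u ⟩
      0ℚ                                 ∎)

  ∷-independent-coordinate : ∀ (u : Υ n) → y u ≡ 1ℚ → (∀ i → xs i u ≡ 0ℚ) → AffinelyIndependent (y Vector.∷ xs)
  ∷-independent-coordinate u y≡1 xs≡0 = ∷-independent head≡0
    where
    open ≡-Reasoning
    head≡0 : ∀ l → sumFin l ≡ 0ℚ → (∀ u → sumFin (λ i → l i * (y Vector.∷ xs) i u) ≡ 0ℚ) → l zero ≡ 0ℚ
    head≡0 l _ ∑ly≡0 = begin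
      l zero                                           ≡⟨ ℚ.*-identityʳ (l zero) ⟨
      l zero * 1ℚ                                      ≡⟨ cong (l zero *_) y≡1 ⟨
      l zero * y u                                     ≡⟨ ℚ.+-identityʳ _ ⟨
      l zero * y u + 0ℚ                                ≡⟨ cong (l zero * y u +_) rest≡0 ⟨
      l zero * y u + sumFin (λ i → l (suc i) * xs i u) ≡⟨ sumFin-suc (λ i → l i * (y Vector.∷ xs) i u) ⟨
      sumFin (λ i → l i * (y Vector.∷ xs) i u)         ≡⟨ ∑ly≡0 u ⟩
      0ℚ                                               ∎
      where
      rest≡0 : sumFin (λ i → l (suc i) * xs i u) ≡ 0ℚ
      rest≡0 = ∑-zero (All.universal (λ i → trans (cong (l (suc i) *_) (xs≡0 i)) (ℚ.*-zeroʳ (l (suc i)))) (allFin k))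

  ∷-independent-zero : ∀ (c : Point n) {d} → d ≢ 0ℚ → (∀ i → c · xs i ≡ d) → (∀ u → y u ≡ 0ℚ) →
                       AffinelyIndependent (y Vector.∷ xs)
  ∷-independent-zero c {d} d≢0 c·x≡d y≡0 = ∷-independent head≡0
    where
    open ≡-Reasoning
    head≡0 : ∀ l → sumFin l ≡ 0ℚ → (∀ u → sumFin (λ i → l i * (y Vector.∷ xs) i u) ≡ 0ℚ) → l zero ≡ 0ℚ
    head≡0 l ∑l≡0 ∑ly≡0 = begin
      l zero                       ≡⟨ ℚ.+-identityʳ (l zero) ⟨
      l zero + 0ℚ                  ≡⟨ cong (l zero +_) (p*q≡0⇒q≡0 d≢0 d*∑l′≡0) ⟨
      l zero + sumFin (l ∘ suc)    ≡⟨ sumFin-suc l ⟨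
      sumFin l                     ≡⟨ ∑l≡0 ⟩
      0ℚ                           ∎
      where
      rest≡0 : ∀ u → sumFin (λ i → l (suc i) * xs i u) ≡ 0ℚ
      rest≡0 u = begin
        sumFin (λ i → l (suc i) * xs i u)                ≡⟨ ℚ.+-identityˡ _ ⟨
        0ℚ + sumFin (λ i → l (suc i) * xs i u)           ≡⟨ cong (_+ _) (trans (cong (l zero *_) (y≡0 u)) (ℚ.*-zeroʳ (l zero))) ⟨
        l zero * y u + sumFin (λ i → l (suc i) * xs i u) ≡⟨ sumFin-suc (λ i → l i * (y Vector.∷ xs) i u) ⟨
        sumFin (λ i → l i * (y Vector.∷ xs) i u)         ≡⟨ ∑ly≡0 u ⟩
        0ℚ                                               ∎
      d*∑l′≡0 : d * sumFin (l ∘ suc) ≡ 0ℚ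
      d*∑l′≡0 = begin
        d * sumFin (l ∘ suc)                   ≡⟨ ∑-*ˡ (allFin k) d (l ∘ suc) ⟨
        sumFin (λ i → d * l (suc i))           ≡⟨ ∑-cong (allFin k) (λ i → trans (ℚ.*-comm d _) (cong (l (suc i) *_) (sym (c·x≡d i)))) ⟩
        sumFin (λ i → l (suc i) * (c · xs i))  ≡⟨ ·-∑ c (allFin k) (l ∘ suc) xs {λ _ → 0ℚ} (sym ∘ rest≡0) ⟨
        c · (λ _ → 0ℚ)                         ≡⟨ ·-zero c _ (λ _ → refl) ⟩
        0ℚ                                     ∎

module FacetWithoutEmptyGraph
  {n e : ℕ} (𝒢 : Graph n → Set) (𝒢-acyclic : ∀ G → 𝒢 G → Acyclic G) (∅∉𝒢 : ¬ 𝒢 (emptyGraph n))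
  (c : Point n) (d : ℚ) (valid : ∀ x → 𝔽 n x → c · x ≤ d)
  (face⊆ : ∀ x → InConv 𝒢 x → 𝔽 n x × c · x ≡ d) (face⊇ : ∀ x → 𝔽 n x → c · x ≡ d → InConv 𝒢 x)
  (xs : Fin (suc e) → Point n) (xs∈face : ∀ i → InConv 𝒢 (xs i)) (xs-independent : AffinelyIndependent xs)
  (dim𝔽≤e+1 : ∀ (zs : Fin (suc (suc (suc e))) → Point n) → (∀ i → 𝔽 n (zs i)) → ¬ AffinelyIndependent zs)
  where

  on-face⇒∈𝒢 : ∀ H → Acyclic H → c · η H ≡ d → 𝒢 H
  on-face⇒∈𝒢 H H-acyclic c·ηH≡d = η-vertex 𝒢-acyclic H H-acyclic (face⊇ (η H) (η∈InConv H H-acyclic) c·ηH≡d)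

  d≢0 : d ≢ 0ℚ
  d≢0 d≡0 = ∅∉𝒢 (on-face⇒∈𝒢 (emptyGraph n) emptyGraph-acyclic (trans (·-zero c (η (emptyGraph n)) η-emptyGraph) (sym d≡0)))

  parents-realised : ∀ (a : Fin n) (B : Subset n) → T (isΥ a B) → ∃ λ G → 𝒢 G × pa G a ≡ B
  parents-realised a B p with Fin.all? (λ i → xs i ((a , B) , p) ℚ.≟ 0ℚ)
  ... | no ¬all-zero =
    let (i , xsᵢ≢0) = Fin.¬∀⟶∃¬ _ _ (λ i → xs i ((a , B) , p) ℚ.≟ 0ℚ) ¬all-zero
    in InConv⇒parents p (xs∈face i) xsᵢ≢0
  ... | yes all-zero = ⊥-elim (dim𝔽≤e+1 zs zs∈𝔽 zs-independent)
    where
    zs : Fin (suc (suc (suc e))) → Point n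
    zs = η (familyGraph a B) Vector.∷ η (emptyGraph n) Vector.∷ xs
    zs∈𝔽 : ∀ i → 𝔽 n (zs i)
    zs∈𝔽 zero          = η∈InConv (familyGraph a B) (familyGraph-acyclic (isΥ⇒∉ p))
    zs∈𝔽 (suc zero)    = η∈InConv (emptyGraph n) emptyGraph-acyclic
    zs∈𝔽 (suc (suc i)) = proj₁ (face⊆ _ (xs∈face i))
    zs-independent : AffinelyIndependent zs
    zs-independent =
      ∷-independent-coordinate
        (∷-independent-zero xs-independent c d≢0 (λ i → proj₂ (face⊆ _ (xs∈face i))) η-emptyGraph)
        ((a , B) , p) (η-≡ (familyGraph a B) p (pa-withParents-≡ (emptyGraph n) a B))
        λ { zero → η-emptyGraph ((a , B) , p) ; (suc i) → all-zero i }

  coef-mono : ∀ a {D D′ : Subset n} → a ∉ D → D′ ⊆ D → coef c a D′ ≤ coef c a D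
  coef-mono a {D} {D′} a∉D D′⊆D with isΥ-or-⊥ a∉D
  ... | inj₂ refl = ℚ.≤-reflexive (cong (coef c a) (Subset.⊆-antisym D′⊆D (Subset.⊆-min D′)))
  ... | inj₁ p with parents-realised a D p
  ...   | K , 𝒢K , paK≡D = begin
    coef c a D′             ≡⟨ cong (coef c a) (pa-withParents-≡ K a D′) ⟨
    coef c a (pa K′ a)      ≤⟨ sumFin-≤-at (λ i → coef c i (pa K′ i)) (λ i → coef c i (pa K i)) a
                                 (λ i i≢a → cong (coef c i) (pa-withParents-≢ K a D′ i≢a)) ∑≤∑ ⟩
    coef c a (pa K a)       ≡⟨ cong (coef c a) paK≡D ⟩
    coef c a D              ∎
    where
    open ℚ.≤-Reasoning
    K′ : Graph n
    K′ = withParents K a D′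
    K′-acyclic : Acyclic K′
    K′-acyclic = ⊆G-acyclic K′ K (withParents-⊆G K a D′ (subst (D′ ⊆_) (sym paK≡D) D′⊆D)) (𝒢-acyclic K 𝒢K)
    ∑≤∑ : sumFin (λ i → coef c i (pa K′ i)) ≤ sumFin (λ i → coef c i (pa K i))
    ∑≤∑ = begin
      sumFin (λ i → coef c i (pa K′ i)) ≡⟨ ·-η c K′ ⟨
      c · η K′                          ≤⟨ valid (η K′) (η∈InConv K′ K′-acyclic) ⟩
      d                                 ≡⟨ proj₂ (face⊆ (η K) (η∈InConv K 𝒢K)) ⟨
      c · η K                           ≡⟨ ·-η c K ⟩
      sumFin (λ i → coef c i (pa K i))  ∎

  upward-closed : ∀ G H → 𝒢 G → Acyclic H → G ⊆G H → 𝒢 H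
  upward-closed G H 𝒢G H-acyclic G⊆H = on-face⇒∈𝒢 H H-acyclic (ℚ.≤-antisym (valid (η H) (η∈InConv H H-acyclic)) (begin
    d                                   ≡⟨ proj₂ (face⊆ (η G) (η∈InConv G 𝒢G)) ⟨
    c · η G                             ≡⟨ ·-η c G ⟩
    sumFin (λ a → coef c a (pa G a))    ≤⟨ ∑-mono-≤ (All.universal coef≤ (allFin n)) ⟩
    sumFin (λ a → coef c a (pa H a))    ≡⟨ ·-η c H ⟨
    c · η H                             ∎))
    where
    open ℚ.≤-Reasoning
    coef≤ : ∀ a → coef c a (pa G a) ≤ coef c a (pa H a)
    coef≤ a = coef-mono a (Acyclic⇒∉pa H H-acyclic a) (pa-mono G H G⊆H a)

corollary2 : ∀ (n : ℕ) → 2 ℕ.≤ n → (𝒢 : Graph n → Set) →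
    IsFacetSet 𝒢 → ¬ 𝒢 (emptyGraph n) →
    (∀ G H → 𝒢 G → Acyclic H → G ⊆G H → 𝒢 H)
    × (∀ (a : Fin n) (B : Subset n) → T (isΥ a B) → ∃ λ G → 𝒢 G × pa G a ≡ B)
corollary2 n _ 𝒢 (𝒢-acyclic , (c , d , valid , face⊆ , face⊇) , e , (_ , dim𝔽≤e+1) , ((xs , xs∈face , xs-independent) , _)) ∅∉𝒢 =
  upward-closed , parents-realised
  where
  open FacetWithoutEmptyGraph 𝒢 𝒢-acyclic ∅∉𝒢 c d valid face⊆ face⊇ xs xs∈face xs-independent dim𝔽≤e+1
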